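{- Let $G$ be a finite graph with $|V(G)|\geq 2$. Then $$\mathfrak{S}(G)\cap\mathcal{M}(G)=\{C\in\mathfrak{M}(G):|C|\geq 2\}=\mathcal{C}(G)\cup\mathcal{S}(G)\cup\mathcal{P}(G).$$
   Context: Graphs are finite, simple, undirected. A module of $G$ is a set $M\subseteq V(G)$ such that each vertex outside $M$ is adjacent to all or none of $M$; trivial modules are $\emptyset$, $V(G)$, singletons; $G$ is prime if $|V(G)|\ge 4$ and all modules are trivial. $\mathcal{M}(G)$ is the family of modules $M$ with $|M|\geq 2$ and $\mathcal{M}_{\min}(G)$ its minimal elements under inclusion. $\mathcal{P}(G)$ is the family of modules $M$ with $G[M]$ prime. $\mathcal{C}(G)$ (resp. $\mathcal{S}(G)$) is the family of maximal elements under inclusion among elements of $\mathcal{M}(G)$ that are cliques (resp. stable sets). The relation $\approx_G$ on $V(G)$: $u\approx_G v$ iff $u=v$ or there is $M\in\mathcal{M}_{\min}(G)$ with $u,v\in M$; it is an equivalence relation, and $\mathfrak{M}(G)$ is its set of classes. A module $M$ is strong if for every module $N$ with $M\cap N\neq\emptyset$, $M\subseteq N$ or $N\subseteq M$. For $W\subsetneq V(G)$, $W^{\Uparrow}$ is the smallest strong module strictly containing $W$ (the strong modules strictly containing $W$ form a chain). $v\leftrightarrow_G w$ iff $\{v\}^{\Uparrow}=\{w\}^{\Uparrow}$; $\mathfrak{S}(G)$ is the set of equivalence classes of $\leftrightarrow_G$. -}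

module Defs where

open import Data.Nat using (ℕ; _≤_; _≥_)
open import Data.Bool using (Bool; true; false)
open import Data.Fin using (Fin)
open import Data.Fin.Subset using (Subset; _∈_; _∉_; _⊆_; _⊂_; ⊥; ⊤; ⁅_⁆; ∣_∣)
open import Data.Product using (Σ; ∃; _×_; _,_)
open import Data.Sum using (_⊎_)
open import Relation.Binary.PropositionalEquality using (_≡_; _≢_)
open import Relation.Nullary using (¬_)

record Graph (n : ℕ) : Set where
  field
    adj    : Fin n → Fin n → Bool
    sym    : ∀ u v → adj u v ≡ adj v u
    irrefl : ∀ v → adj v v ≡ false
open Graph public

module _ {n : ℕ} (G : Graph n) where

  IsModule : Subset n → Set
  IsModule M = ∀ x → x ∉ M → ∀ u v → u ∈ M → v ∈ M → adj G x u ≡ adj G x v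

  InM : Subset n → Set
  InM M = IsModule M × 2 ≤ ∣ M ∣

  InMmin : Subset n → Set
  InMmin M = InM M × (∀ N → InM N → N ⊆ M → N ≡ M)

  IsModuleIn : Subset n → Subset n → Set
  IsModuleIn M N = N ⊆ M ×
    (∀ x → x ∈ M → x ∉ N → ∀ u v → u ∈ N → v ∈ N → adj G x u ≡ adj G x v)

  PrimeOn : Subset n → Set
  PrimeOn M = 4 ≤ ∣ M ∣ ×
    (∀ N → IsModuleIn M N → N ≡ ⊥ ⊎ N ≡ M ⊎ ∣ N ∣ ≡ 1)

  InP : Subset n → Set
  InP M = IsModule M × PrimeOn M

  IsClique : Subset n → Set
  IsClique M = ∀ u v → u ∈ M → v ∈ M → u ≢ v → adj G u v ≡ true

  IsStable : Subset n → Set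
  IsStable M = ∀ u v → u ∈ M → v ∈ M → adj G u v ≡ false

  InC : Subset n → Set
  InC M = (InM M × IsClique M) × (∀ N → InM N → IsClique N → M ⊆ N → N ≡ M)

  InS : Subset n → Set
  InS M = (InM M × IsStable M) × (∀ N → InM N → IsStable N → M ⊆ N → N ≡ M)

  _≈G_ : Fin n → Fin n → Set
  u ≈G v = u ≡ v ⊎ Σ (Subset n) (λ M → InMmin M × u ∈ M × v ∈ M)

  InFrakM : Subset n → Set
  InFrakM C = Σ (Fin n) (λ u → u ∈ C × (∀ v → v ∈ C → u ≈G v) × (∀ v → u ≈G v → v ∈ C))

  IsStrong : Subset n → Set
  IsStrong M = IsModule M ×
    (∀ N → IsModule N → Σ (Fin n) (λ x → x ∈ M × x ∈ N) → M ⊆ N ⊎ N ⊆ M)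

  IsUp : Subset n → Subset n → Set
  IsUp W U = (IsStrong U × W ⊂ U) × (∀ S → IsStrong S → W ⊂ S → U ⊆ S)

  _↔G_ : Fin n → Fin n → Set
  v ↔G w = Σ (Subset n) (λ U → IsUp ⁅ v ⁆ U × IsUp ⁅ w ⁆ U)

  InFrakS : Subset n → Set
  InFrakS C = Σ (Fin n) (λ u → u ∈ C × (∀ v → v ∈ C → u ↔G v) × (∀ v → u ↔G v → v ∈ C))

-- A minimal module with two vertices is a pair of twins. One with at least three vertices is
-- strong, has at least four vertices (among three vertices one sees the other two alike, and
-- these two would form a smaller module) and is prime. So an ≈-class with two or more vertices
-- is either a prime minimal module or the set of all twins of a vertex, which is a module that
-- is a maximal clique or maximal stable module; conversely every member of 𝒞, 𝒮 and 𝒫 is a class.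
--
-- For ↔ the key facts concern a module U contained in {c}^⇑. If G[U] or its complement is
-- disconnected, the smallest union of components containing c is strong, hence is {c}, so c is
-- joined uniformly to the rest of U and any two such vertices are twins. Otherwise a maximal
-- proper submodule of U would be strong (a module crossing it disconnects G[U] or its
-- complement), so every module containing c and a second vertex of U contains U. Applied to
-- U = {u}^⇑ and to a ↔-class that is a module, this shows that the two kinds of classes agree.

module Submission where

open import Data.Bool using (Bool; true; false)
open import Data.Bool.Properties using () renaming (_≟_ to _≟ᵇ_)
open import Data.Empty using (⊥; ⊥-elim)
open import Data.Fin using (Fin; _≟_)
open import Data.Fin.Properties using (any?; all?)
open import Data.Fin.Subset renaming (⊥ to ∅)
open import Data.Fin.Subset.Properties
open import Data.Nat using (ℕ; suc; _≤_; _<_; _+_; z≤n; s≤s; _≤?_)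
open import Data.Nat.Induction using (<-wellFounded)
open import Data.Nat.Properties
  using (≤-trans; ≤-reflexive; ≤-pred; +-suc; +-comm; +-monoʳ-≤; ≰⇒>; <⇒≱; module ≤-Reasoning)
open import Data.Product using (Σ; ∃; ∃₂; _×_; _,_; proj₁; proj₂)
open import Data.Sum using (_⊎_; inj₁; inj₂; [_,_]′; map₂)
open import Data.Vec.Base using ([]; _∷_; here; there)
open import Function.Base using (_∘_)
open import Function.Bundles using (_⇔_; mk⇔)
open import Induction.WellFounded using (Acc; acc)
import Relation.Binary.Construct.On as On
open import Relation.Binary.PropositionalEquality
  using (_≡_; _≢_; refl; sym; trans; cong; cong₂; subst; ≢-sym; module ≡-Reasoning)
open import Relation.Nullary using (Dec; yes; no; ¬_; contradiction)
open import Relation.Nullary.Decidable using (_×-dec_; _→-dec_; _⊎-dec_; ¬?; decidable-stable)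
open import Relation.Unary using (Decidable)

open import Defs hiding (sym)

-- Finite subsets

x∈p─q⇒x∉q : ∀ {n} {x : Fin n} (p q : Subset n) → x ∈ p ─ q → x ∉ q
x∈p─q⇒x∉q (inside ∷ p) (outside ∷ q) here       ()
x∈p─q⇒x∉q (s ∷ p)      (t ∷ q)       (there x∈) (there x∈q) = x∈p─q⇒x∉q p q x∈ x∈q

∣p∪q∣≤∣p∣+∣q∣ : ∀ {n} (p q : Subset n) → ∣ p ∪ q ∣ ≤ ∣ p ∣ + ∣ q ∣
∣p∪q∣≤∣p∣+∣q∣ []            []           = z≤n
∣p∪q∣≤∣p∣+∣q∣ (inside ∷ p)  (s ∷ q)      =
  s≤s (≤-trans (∣p∪q∣≤∣p∣+∣q∣ p q) (+-monoʳ-≤ ∣ p ∣ (∣p∣≤∣x∷p∣ s q)))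
∣p∪q∣≤∣p∣+∣q∣ (outside ∷ p) (inside ∷ q) =
  ≤-trans (s≤s (∣p∪q∣≤∣p∣+∣q∣ p q)) (≤-reflexive (sym (+-suc ∣ p ∣ ∣ q ∣)))
∣p∪q∣≤∣p∣+∣q∣ (outside ∷ p) (outside ∷ q) = ∣p∪q∣≤∣p∣+∣q∣ p q

module _ {n : ℕ} where

  ⊈⇒∃ : {p q : Subset n} → ¬ p ⊆ q → ∃ λ x → x ∈ p × x ∉ q
  ⊈⇒∃ {p} {q} p⊈q with any? (λ x → x ∈? p ×-dec ¬? (x ∈? q))
  ... | yes witness = witness
  ... | no ∄ = contradiction (λ {x} x∈p → decidable-stable (x ∈? q) (λ x∉q → ∄ (x , x∈p , x∉q))) p⊈q

  ⊆∧∣q∣≤∣p∣⇒≡ : {p q : Subset n} → p ⊆ q → ∣ q ∣ ≤ ∣ p ∣ → p ≡ q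
  ⊆∧∣q∣≤∣p∣⇒≡ {p} {q} p⊆q ∣q∣≤∣p∣ = ⊆-antisym p⊆q (decidable-stable (q ⊆? p) q⊆p)
    where
    q⊆p : ¬ ¬ q ⊆ p
    q⊆p q⊈p = <⇒≱ (p⊂q⇒∣p∣<∣q∣ (p⊆q , ⊈⇒∃ q⊈p)) ∣q∣≤∣p∣

  x∈p-y⇒x≢y : {x y : Fin n} {p : Subset n} → x ∈ p - y → x ≢ y
  x∈p-y⇒x≢y {y = y} {p} x∈ = x∉⁅y⁆⇒x≢y (x∈p─q⇒x∉q p ⁅ y ⁆ x∈)

  ∣p∣≤1+∣p-x∣ : (p : Subset n) (x : Fin n) → ∣ p ∣ ≤ suc ∣ p - x ∣
  ∣p∣≤1+∣p-x∣ p x = begin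
    ∣ p ∣                   ≤⟨ p⊆q⇒∣p∣≤∣q∣ p⊆p-x∪x ⟩
    ∣ (p - x) ∪ ⁅ x ⁆ ∣     ≤⟨ ∣p∪q∣≤∣p∣+∣q∣ (p - x) ⁅ x ⁆ ⟩
    ∣ p - x ∣ + ∣ ⁅ x ⁆ ∣   ≡⟨ cong (∣ p - x ∣ +_) (∣⁅x⁆∣≡1 x) ⟩
    ∣ p - x ∣ + 1           ≡⟨ +-comm ∣ p - x ∣ 1 ⟩
    suc ∣ p - x ∣           ∎
    where
    open ≤-Reasoning
    p⊆p-x∪x : p ⊆ (p - x) ∪ ⁅ x ⁆
    p⊆p-x∪x {y} y∈p with y ≟ x
    ... | yes refl = x∈p∪q⁺ (inj₂ (x∈⁅x⁆ x))
    ... | no y≢x   = x∈p∪q⁺ (inj₁ (x∈p∧x≢y⇒x∈p-y y∈p y≢x))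

  1≤∣p∣⇒Nonempty : {p : Subset n} → 1 ≤ ∣ p ∣ → Nonempty p
  1≤∣p∣⇒Nonempty {p} 1≤∣p∣ with nonempty? p
  ... | yes ne = ne
  ... | no empty with ≤-trans 1≤∣p∣ (≤-reflexive (trans (cong ∣_∣ (Empty-unique empty)) (∣⊥∣≡0 n)))
  ...   | ()

  another-element : {p : Subset n} (x : Fin n) → 2 ≤ ∣ p ∣ → ∃ λ y → y ∈ p × y ≢ x
  another-element {p} x 2≤∣p∣ with 1≤∣p∣⇒Nonempty (≤-pred (≤-trans 2≤∣p∣ (∣p∣≤1+∣p-x∣ p x)))
  ... | y , y∈p-x = y , p─q⊆p p ⁅ x ⁆ y∈p-x , x∈p-y⇒x≢y y∈p-x

  ∈∧≤∣p-x∣⇒<∣p∣ : {p : Subset n} {x : Fin n} {k : ℕ} → x ∈ p → k ≤ ∣ p - x ∣ → suc k ≤ ∣ p ∣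
  ∈∧≤∣p-x∣⇒<∣p∣ x∈p k≤ = ≤-trans (s≤s k≤) (x∈p⇒∣p-x∣<∣p∣ x∈p)

  private
    ∈p-x : {p : Subset n} {x y : Fin n} → y ∈ p → x ≢ y → y ∈ p - x
    ∈p-x y∈p x≢y = x∈p∧x≢y⇒x∈p-y y∈p (≢-sym x≢y)

  distinct⇒2≤∣p∣ : {p : Subset n} {x y : Fin n} → x ∈ p → y ∈ p → x ≢ y → 2 ≤ ∣ p ∣
  distinct⇒2≤∣p∣ x∈p y∈p x≢y = ∈∧≤∣p-x∣⇒<∣p∣ x∈p (∈∧≤∣p-x∣⇒<∣p∣ (∈p-x y∈p x≢y) z≤n)

  distinct⇒3≤∣p∣ : {p : Subset n} {x y z : Fin n} → x ∈ p → y ∈ p → z ∈ p →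
                   x ≢ y → x ≢ z → y ≢ z → 3 ≤ ∣ p ∣
  distinct⇒3≤∣p∣ x∈p y∈p z∈p x≢y x≢z y≢z =
    ∈∧≤∣p-x∣⇒<∣p∣ x∈p (distinct⇒2≤∣p∣ (∈p-x y∈p x≢y) (∈p-x z∈p x≢z) y≢z)

  distinct⇒4≤∣p∣ : {p : Subset n} {x y z w : Fin n} → x ∈ p → y ∈ p → z ∈ p → w ∈ p →
                   x ≢ y → x ≢ z → x ≢ w → y ≢ z → y ≢ w → z ≢ w → 4 ≤ ∣ p ∣
  distinct⇒4≤∣p∣ x∈p y∈p z∈p w∈p x≢y x≢z x≢w y≢z y≢w z≢w =
    ∈∧≤∣p-x∣⇒<∣p∣ x∈p (distinct⇒3≤∣p∣ (∈p-x y∈p x≢y) (∈p-x z∈p x≢z) (∈p-x w∈p x≢w) y≢z y≢w z≢w)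

  three-distinct : {p : Subset n} → 3 ≤ ∣ p ∣ →
                   ∃₂ λ x y → ∃ λ z → x ∈ p × y ∈ p × z ∈ p × x ≢ y × x ≢ z × y ≢ z
  three-distinct {p} 3≤∣p∣ with 1≤∣p∣⇒Nonempty {p} (≤-trans (s≤s z≤n) 3≤∣p∣)
  ... | x , x∈p with another-element {p - x} x (≤-pred (≤-trans 3≤∣p∣ (∣p∣≤1+∣p-x∣ p x)))
  ...   | y , y∈p-x , _ with another-element {p - x} y (≤-pred (≤-trans 3≤∣p∣ (∣p∣≤1+∣p-x∣ p x)))
  ...     | z , z∈p-x , z≢y =
    x , y , z , x∈p , p─q⊆p p ⁅ x ⁆ y∈p-x , p─q⊆p p ⁅ x ⁆ z∈p-x ,
    ≢-sym (x∈p-y⇒x≢y y∈p-x) , ≢-sym (x∈p-y⇒x≢y z∈p-x) , ≢-sym z≢y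

  ⁅x⁆⊂⁺ : {S : Subset n} {x y : Fin n} → x ∈ S → y ∈ S → y ≢ x → ⁅ x ⁆ ⊂ S
  ⁅x⁆⊂⁺ {x = x} x∈S y∈S y≢x =
    (λ z∈x → subst (_∈ _) (sym (x∈⁅y⁆⇒x≡y x z∈x)) x∈S) , _ , y∈S , x≢y⇒x∉⁅y⁆ y≢x

  ⁅x⁆⊂⇒∈ : {S : Subset n} {x : Fin n} → ⁅ x ⁆ ⊂ S → x ∈ S
  ⁅x⁆⊂⇒∈ {x = x} (x⊆S , _) = x⊆S (x∈⁅x⁆ x)

  ⁅x⁆⊂⇒∃ : {S : Subset n} {x : Fin n} → ⁅ x ⁆ ⊂ S → ∃ λ y → y ∈ S × y ≢ x
  ⁅x⁆⊂⇒∃ (_ , y , y∈S , y∉x) = y , y∈S , x∉⁅y⁆⇒x≢y y∉x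

  pair : Fin n → Fin n → Subset n
  pair u w = ⁅ u ⁆ ∪ ⁅ w ⁆

  u∈pair : (u w : Fin n) → u ∈ pair u w
  u∈pair u w = x∈p∪q⁺ (inj₁ (x∈⁅x⁆ u))

  w∈pair : (u w : Fin n) → w ∈ pair u w
  w∈pair u w = x∈p∪q⁺ (inj₂ (x∈⁅x⁆ w))

  ∈pair⁻ : {u w x : Fin n} → x ∈ pair u w → x ≡ u ⊎ x ≡ w
  ∈pair⁻ {u} {w} x∈ with x∈p∪q⁻ ⁅ u ⁆ ⁅ w ⁆ x∈
  ... | inj₁ x∈u = inj₁ (x∈⁅y⁆⇒x≡y u x∈u)
  ... | inj₂ x∈w = inj₂ (x∈⁅y⁆⇒x≡y w x∈w)

  pair⊆ : {S : Subset n} {u w : Fin n} → u ∈ S → w ∈ S → pair u w ⊆ S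
  pair⊆ u∈S w∈S x∈ with ∈pair⁻ x∈
  ... | inj₁ refl = u∈S
  ... | inj₂ refl = w∈S

  ∣pair∣≤2 : (u w : Fin n) → ∣ pair u w ∣ ≤ 2
  ∣pair∣≤2 u w = ≤-trans (∣p∪q∣≤∣p∣+∣q∣ ⁅ u ⁆ ⁅ w ⁆)
                         (≤-reflexive (cong₂ _+_ (∣⁅x⁆∣≡1 u) (∣⁅x⁆∣≡1 w)))

  allSubset? : {P : Subset n → Set} → Decidable P → Dec (∀ S → P S)
  allSubset? P? with anySubset? (λ S → ¬? (P? S))
  ... | yes (S , ¬PS) = no λ ∀P → ¬PS (∀P S)
  ... | no ∄ = yes λ S → decidable-stable (P? S) (λ ¬PS → ∄ (S , ¬PS))

  module _ {P : Subset n → Set} (P? : Decidable P) where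

    ⊆-minimal : ∀ S → P S → ∃ λ S* → P S* × S* ⊆ S × (∀ T → P T → T ⊆ S* → S* ⊆ T)
    ⊆-minimal S = go S (On.wellFounded ∣_∣ <-wellFounded S)
      where
      go : ∀ S → Acc (λ T S → ∣ T ∣ < ∣ S ∣) S → P S →
           ∃ λ S* → P S* × S* ⊆ S × (∀ T → P T → T ⊆ S* → S* ⊆ T)
      go S (acc smaller) PS with anySubset? (λ T → P? T ×-dec T ⊂? S)
      ... | yes (T , PT , T⊂S) with go T (smaller (p⊂q⇒∣p∣<∣q∣ T⊂S)) PT
      ...   | S* , PS* , S*⊆T , min = S* , PS* , ⊆-trans S*⊆T (p⊂q⇒p⊆q T⊂S) , min
      go S _ PS | no ∄ = S , PS , ⊆-refl , λ T PT T⊆S →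
        decidable-stable (S ⊆? T) (λ S⊈T → ∄ (T , PT , T⊆S , ⊈⇒∃ S⊈T))

    ⊆-maximal : ∀ S → P S → ∃ λ S* → P S* × S ⊆ S* × (∀ T → P T → S* ⊆ T → T ⊆ S*)
    ⊆-maximal S = go S (On.wellFounded (λ S → ∣ ∁ S ∣) <-wellFounded S)
      where
      go : ∀ S → Acc (λ T S → ∣ ∁ T ∣ < ∣ ∁ S ∣) S → P S →
           ∃ λ S* → P S* × S ⊆ S* × (∀ T → P T → S* ⊆ T → T ⊆ S*)
      go S (acc smaller) PS with anySubset? (λ T → P? T ×-dec S ⊂? T)
      ... | yes (T , PT , S⊂T) with go T (smaller (p⊂q⇒∣p∣<∣q∣ (p⊂q⇒∁p⊃∁q S⊂T))) PT
      ...   | S* , PS* , T⊆S* , max = S* , PS* , ⊆-trans (p⊂q⇒p⊆q S⊂T) T⊆S* , max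
      go S _ PS | no ∄ = S , PS , ⊆-refl , λ T PT S⊆T →
        decidable-stable (T ⊆? S) (λ T⊈S → ∄ (T , PT , S⊆T , ⊈⇒∃ T⊈S))

bool-pigeonhole : (x y z : Bool) → x ≡ y ⊎ x ≡ z ⊎ y ≡ z
bool-pigeonhole false false _     = inj₁ refl
bool-pigeonhole true  true  _     = inj₁ refl
bool-pigeonhole false true  false = inj₂ (inj₁ refl)
bool-pigeonhole true  false true  = inj₂ (inj₁ refl)
bool-pigeonhole false true  true  = inj₂ (inj₂ refl)
bool-pigeonhole true  false false = inj₂ (inj₂ refl)

-- Modules and twins

module _ {n : ℕ} (G : Graph n) where

  private
    A : Fin n → Fin n → Bool
    A = adj G

    A-sym : ∀ x y → A x y ≡ A y x
    A-sym = Graph.sym G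

  IsModule? : Decidable (IsModule G)
  IsModule? M = all? λ x → ¬? (x ∈? M) →-dec all? λ u → all? λ v →
    u ∈? M →-dec (v ∈? M →-dec (A x u ≟ᵇ A x v))

  IsStrong? : Decidable (IsStrong G)
  IsStrong? M = IsModule? M ×-dec allSubset? λ N →
    IsModule? N →-dec (any? (λ x → x ∈? M ×-dec x ∈? N) →-dec (M ⊆? N ⊎-dec N ⊆? M))

  IsModule-∩ : ∀ {M N} → IsModule G M → IsModule G N → IsModule G (M ∩ N)
  IsModule-∩ {M} {N} modM modN x x∉M∩N u v u∈ v∈ with x ∈? M
  ... | yes x∈M = modN x (λ x∈N → x∉M∩N (x∈p∩q⁺ (x∈M , x∈N))) u v (p∩q⊆q M N u∈) (p∩q⊆q M N v∈)
  ... | no x∉M  = modM x x∉M u v (p∩q⊆p M N u∈) (p∩q⊆p M N v∈)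

  IsModule-∪ : ∀ {M N z} → IsModule G M → IsModule G N → z ∈ M → z ∈ N → IsModule G (M ∪ N)
  IsModule-∪ {M} {N} {z} modM modN z∈M z∈N x x∉M∪N u v u∈ v∈ = trans (A-z u u∈) (sym (A-z v v∈))
    where
    A-z : ∀ y → y ∈ M ∪ N → A x y ≡ A x z
    A-z y y∈ with x∈p∪q⁻ M N y∈
    ... | inj₁ y∈M = modM x (λ x∈M → x∉M∪N (p⊆p∪q N x∈M)) y z y∈M z∈M
    ... | inj₂ y∈N = modN x (λ x∈N → x∉M∪N (q⊆p∪q M N x∈N)) y z y∈N z∈N

  IsModule-─ : ∀ {M N t} → IsModule G M → IsModule G N → t ∈ N → t ∉ M → IsModule G (M ─ N)
  IsModule-─ {M} {N} {t} modM modN t∈N t∉M x x∉M─N u v u∈ v∈ with x ∈? M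
  ... | no x∉M = modM x x∉M u v (p─q⊆p M N u∈) (p─q⊆p M N v∈)
  ... | yes x∈M = begin
    A x u  ≡⟨ A-sym x u ⟩
    A u x  ≡⟨ modN u (x∈p─q⇒x∉q M N u∈) x t x∈N t∈N ⟩
    A u t  ≡⟨ A-sym u t ⟩
    A t u  ≡⟨ modM t t∉M u v (p─q⊆p M N u∈) (p─q⊆p M N v∈) ⟩
    A t v  ≡⟨ A-sym t v ⟩
    A v t  ≡⟨ modN v (x∈p─q⇒x∉q M N v∈) t x t∈N x∈N ⟩
    A v x  ≡⟨ A-sym v x ⟩
    A x v  ∎
    where
    open ≡-Reasoning
    x∈N : x ∈ N
    x∈N = decidable-stable (x ∈? N) (λ x∉N → x∉M─N (x∈p∧x∉q⇒x∈p─q x∈M x∉N))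

  IsModuleIn⇒IsModule : ∀ {M N} → IsModule G M → IsModuleIn G M N → IsModule G N
  IsModuleIn⇒IsModule {M} modM (N⊆M , modN) x x∉N u v u∈N v∈N with x ∈? M
  ... | yes x∈M = modN x x∈M x∉N u v u∈N v∈N
  ... | no x∉M  = modM x x∉M u v (N⊆M u∈N) (N⊆M v∈N)

  IsModule⇒IsModuleIn : ∀ {M N} → N ⊆ M → IsModule G N → IsModuleIn G M N
  IsModule⇒IsModuleIn N⊆M modN = N⊆M , λ x _ → modN x

  Twins : Fin n → Fin n → Set
  Twins u x = ∀ y → y ≢ u → y ≢ x → A y u ≡ A y x

  twins-refl : ∀ u → Twins u u
  twins-refl u _ _ _ = refl

  twin-adj : ∀ {u a b} → Twins u b → a ≢ u → a ≢ b → A a b ≡ A a u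
  twin-adj twins-b a≢u a≢b = sym (twins-b _ a≢u a≢b)

  twins-same-adj : ∀ {u a b} → Twins u a → Twins u b → a ≢ u → b ≢ u → A u a ≡ A u b
  twins-same-adj {u} {a} {b} twins-a twins-b a≢u b≢u with a ≟ b
  ... | yes refl = refl
  ... | no a≢b = begin
    A u a  ≡⟨ A-sym u a ⟩
    A a u  ≡⟨ sym (twin-adj twins-b a≢u a≢b) ⟩
    A a b  ≡⟨ A-sym a b ⟩
    A b a  ≡⟨ twin-adj twins-a b≢u (≢-sym a≢b) ⟩
    A b u  ≡⟨ A-sym b u ⟩
    A u b  ∎
    where open ≡-Reasoning

  twin-set-module : ∀ {u C} → u ∈ C → (∀ a → a ∈ C → Twins u a) → IsModule G C
  twin-set-module {C = C} u∈C twins x x∉C a b a∈C b∈C =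
    trans (sym (twins a a∈C x (x≢ u∈C) (x≢ a∈C))) (twins b b∈C x (x≢ u∈C) (x≢ b∈C))
    where
    x≢ : ∀ {y} → y ∈ C → x ≢ y
    x≢ y∈C refl = x∉C y∈C

  small-module-twins : ∀ {M u x} → IsModule G M → u ∈ M → x ∈ M → x ≢ u → ∣ M ∣ ≤ 2 → Twins u x
  small-module-twins {M} {u} {x} modM u∈M x∈M x≢u ∣M∣≤2 y y≢u y≢x with y ∈? M
  ... | no y∉M  = modM y y∉M u x u∈M x∈M
  ... | yes y∈M = contradiction ∣M∣≤2
        (<⇒≱ (distinct⇒3≤∣p∣ u∈M x∈M y∈M (≢-sym x≢u) (≢-sym y≢u) (≢-sym y≢x)))

  Uniform : Bool → Subset n → Set
  Uniform e M = ∀ a b → a ∈ M → b ∈ M → a ≢ b → A a b ≡ e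

  uniform-module-twins : ∀ {e M u x} → IsModule G M → Uniform e M → u ∈ M → x ∈ M → Twins u x
  uniform-module-twins {M = M} {u} {x} modM unif u∈M x∈M y y≢u y≢x with y ∈? M
  ... | yes y∈M = trans (unif y u y∈M u∈M y≢u) (sym (unif y x y∈M x∈M y≢x))
  ... | no y∉M  = modM y y∉M u x u∈M x∈M

  twin-set-uniform : ∀ {u w C} → (∀ a → a ∈ C → Twins u a) → Twins u w → w ≢ u →
                     Uniform (A u w) C
  twin-set-uniform {u} {w} {C} twins twins-w w≢u = uniform
    where
    A-u-w : ∀ a → a ∈ C → a ≢ u → A u a ≡ A u w
    A-u-w a a∈ a≢u = twins-same-adj (twins a a∈) twins-w a≢u w≢u

    uniform : Uniform (A u w) C
    uniform a b a∈ b∈ a≢b with a ≟ u | b ≟ u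
    ... | yes refl | _        = A-u-w b b∈ (≢-sym a≢b)
    ... | no a≢u   | yes refl = trans (A-sym a u) (A-u-w a a∈ a≢u)
    ... | no a≢u   | no _     =
      trans (twin-adj (twins b b∈) a≢u a≢b) (trans (A-sym a u) (A-u-w a a∈ a≢u))

  pair-twins-module : ∀ {u x} → Twins u x → IsModule G (pair u x)
  pair-twins-module {u} {x} twins-x = twin-set-module (u∈pair u x) twins
    where
    twins : ∀ a → a ∈ pair u x → Twins u a
    twins a a∈ with ∈pair⁻ a∈
    ... | inj₁ refl = twins-refl u
    ... | inj₂ refl = twins-x

  pair-minimal : ∀ {u x} → x ≢ u → Twins u x → InMmin G (pair u x)
  pair-minimal {u} {x} x≢u twins-x =
    (pair-twins-module twins-x , distinct⇒2≤∣p∣ (u∈pair u x) (w∈pair u x) (≢-sym x≢u)) ,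
    λ N (_ , 2≤∣N∣) N⊆pair → ⊆∧∣q∣≤∣p∣⇒≡ N⊆pair (≤-trans (∣pair∣≤2 u x) 2≤∣N∣)

  twins⇒≈ : ∀ {u x} → Twins u x → _≈G_ G u x
  twins⇒≈ {u} {x} twins-x with x ≟ u
  ... | yes refl = inj₁ refl
  ... | no x≢u   = inj₂ (pair u x , pair-minimal x≢u twins-x , u∈pair u x , w∈pair u x)

  -- Minimal modules

  minimal-strong : ∀ {M} → InMmin G M → 3 ≤ ∣ M ∣ → IsStrong G M
  minimal-strong {M} ((modM , _) , minM) 3≤∣M∣ = modM , nested
    where
    nested : ∀ N → IsModule G N → Σ (Fin n) (λ x → x ∈ M × x ∈ N) → M ⊆ N ⊎ N ⊆ M
    nested N modN (x , x∈M , x∈N) with any? (λ v → v ∈? M ∩ N ×-dec ¬? (v ≟ x))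
    ... | yes (v , v∈M∩N , v≢x) = inj₁ (⊆-trans (⊆-reflexive (sym M∩N≡M)) (p∩q⊆q M N))
      where
      M∩N≡M : M ∩ N ≡ M
      M∩N≡M = minM (M ∩ N)
        (IsModule-∩ modM modN , distinct⇒2≤∣p∣ (x∈p∩q⁺ (x∈M , x∈N)) v∈M∩N (≢-sym v≢x))
        (p∩q⊆p M N)
    ... | no ∄ with N ⊆? M
    ...   | yes N⊆M = inj₂ N⊆M
    ...   | no N⊈M with ⊈⇒∃ N⊈M
    ...     | t , t∈N , t∉M = contradiction x∈N (x∈p─q⇒x∉q M N (subst (x ∈_) (sym M─N≡M) x∈M))
      where
      M-x⊆M─N : M - x ⊆ M ─ N
      M-x⊆M─N {y} y∈ = x∈p∧x∉q⇒x∈p─q y∈M λ y∈N → ∄ (y , x∈p∩q⁺ (y∈M , y∈N) , x∈p-y⇒x≢y y∈)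
        where
        y∈M : y ∈ M
        y∈M = p─q⊆p M ⁅ x ⁆ y∈
      M─N≡M : M ─ N ≡ M
      M─N≡M = minM (M ─ N)
        (IsModule-─ modM modN t∈N t∉M ,
         ≤-trans (≤-pred (≤-trans 3≤∣M∣ (∣p∣≤1+∣p-x∣ M x))) (p⊆q⇒∣p∣≤∣q∣ M-x⊆M─N))
        (p─q⊆p M N)

  minimal-overlap : ∀ {M N x} → InMmin G M → 3 ≤ ∣ M ∣ → InMmin G N → x ∈ M → x ∈ N → N ≡ M
  minimal-overlap {M} {N} {x} minM 3≤∣M∣ minN x∈M x∈N
    with proj₂ (minimal-strong minM 3≤∣M∣) N (proj₁ (proj₁ minN)) (x , x∈M , x∈N)
  ... | inj₁ M⊆N = sym (proj₂ minN M (proj₁ minM) M⊆N)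
  ... | inj₂ N⊆M = proj₂ minM N (proj₁ minN) N⊆M

  ≈-twins : ∀ {u w x} → Twins u w → w ≢ u → _≈G_ G u x → Twins u x
  ≈-twins {u} _ _ (inj₁ refl) = twins-refl u
  ≈-twins {u} {w} {x} twins-w w≢u (inj₂ (N , minN , u∈N , x∈N)) with x ≟ u | ∣ N ∣ ≤? 2
  ... | yes refl | _        = twins-refl u
  ... | no x≢u   | yes ∣N∣≤2 = small-module-twins (proj₁ (proj₁ minN)) u∈N x∈N x≢u ∣N∣≤2
  ... | no _     | no ∣N∣≰2  = contradiction ∣N∣≤2 ∣N∣≰2
    where
    ∣N∣≤2 : ∣ N ∣ ≤ 2
    ∣N∣≤2 = subst (λ P → ∣ P ∣ ≤ 2)
      (minimal-overlap minN (≰⇒> ∣N∣≰2) (pair-minimal w≢u twins-w) u∈N (u∈pair u w)) (∣pair∣≤2 u w)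

  private
    triangle-no-twins : ∀ {M a b c} → InMmin G M → ∣ M ∣ ≤ 3 → a ∈ M → b ∈ M → c ∈ M →
                        a ≢ b → a ≢ c → b ≢ c → A c a ≢ A c b
    triangle-no-twins {M} {a} {b} {c} ((modM , _) , minM) ∣M∣≤3 a∈M b∈M c∈M a≢b a≢c b≢c
                      c-sees-a-b-alike =
      [ ≢-sym a≢c , ≢-sym b≢c ]′ (∈pair⁻ (subst (c ∈_) (sym pair≡M) c∈M))
      where
      twins-b : Twins a b
      twins-b y y≢a y≢b with y ∈? M | y ≟ c
      ... | no y∉M | _        = modM y y∉M a b a∈M b∈M
      ... | yes _  | yes refl = c-sees-a-b-alike
      ... | yes y∈M | no y≢c  = contradiction ∣M∣≤3 (<⇒≱
            (distinct⇒4≤∣p∣ a∈M b∈M c∈M y∈M a≢b a≢c (≢-sym y≢a) b≢c (≢-sym y≢b) (≢-sym y≢c)))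
      pair≡M : pair a b ≡ M
      pair≡M = minM (pair a b) (proj₁ (pair-minimal (≢-sym a≢b) twins-b)) (pair⊆ a∈M b∈M)

  minimal-4≤ : ∀ {M} → InMmin G M → 3 ≤ ∣ M ∣ → 4 ≤ ∣ M ∣
  minimal-4≤ {M} minM 3≤∣M∣ with ∣ M ∣ ≤? 3
  ... | no ∣M∣≰3  = ≰⇒> ∣M∣≰3
  ... | yes ∣M∣≤3 = ⊥-elim (some-vertex-sees-alike (three-distinct 3≤∣M∣))
    where
    some-vertex-sees-alike : ¬ ∃₂ λ u w → ∃ λ z → u ∈ M × w ∈ M × z ∈ M × u ≢ w × u ≢ z × w ≢ z
    some-vertex-sees-alike (u , w , z , u∈ , w∈ , z∈ , u≢w , u≢z , w≢z)
      with bool-pigeonhole (A u w) (A u z) (A w z)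
    ... | inj₁ same-u =
      triangle-no-twins minM ∣M∣≤3 w∈ z∈ u∈ w≢z (≢-sym u≢w) (≢-sym u≢z) same-u
    ... | inj₂ (inj₁ same-w) =
      triangle-no-twins minM ∣M∣≤3 u∈ z∈ w∈ u≢z u≢w (≢-sym w≢z) (trans (A-sym w u) same-w)
    ... | inj₂ (inj₂ same-z) =
      triangle-no-twins minM ∣M∣≤3 u∈ w∈ z∈ u≢w u≢z w≢z
        (trans (A-sym z u) (trans same-z (A-sym w z)))

  minimal-prime : ∀ {M} → InMmin G M → 3 ≤ ∣ M ∣ → InP G M
  minimal-prime {M} minM@((modM , _) , isMin) 3≤∣M∣ = modM , minimal-4≤ minM 3≤∣M∣ , trivial
    where
    trivial : ∀ N → IsModuleIn G M N → N ≡ ∅ ⊎ N ≡ M ⊎ ∣ N ∣ ≡ 1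
    trivial N modN with ∣ N ∣ in ∣N∣≡
    ... | 0 = inj₁ (sym (⊆∧∣q∣≤∣p∣⇒≡ ⊥⊆ (≤-reflexive (trans ∣N∣≡ (sym (∣⊥∣≡0 n))))))
    ... | 1 = inj₂ (inj₂ refl)
    ... | suc (suc _) = inj₂ (inj₁ (isMin N
          (IsModuleIn⇒IsModule modM modN , subst (2 ≤_) (sym ∣N∣≡) (s≤s (s≤s z≤n))) (proj₁ modN)))

  prime-minimal : ∀ {M} → InP G M → InMmin G M
  prime-minimal {M} (modM , 4≤∣M∣ , trivial) = (modM , ≤-trans (s≤s (s≤s z≤n)) 4≤∣M∣) , isMin
    where
    isMin : ∀ N → InM G N → N ⊆ M → N ≡ M
    isMin N (modN , 2≤∣N∣) N⊆M with trivial N (IsModule⇒IsModuleIn N⊆M modN)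
    ... | inj₁ refl      = contradiction (≤-trans 2≤∣N∣ (≤-reflexive (∣⊥∣≡0 n))) λ ()
    ... | inj₂ (inj₁ eq) = eq
    ... | inj₂ (inj₂ eq) = contradiction (≤-trans 2≤∣N∣ (≤-reflexive eq)) λ { (s≤s ()) }

  -- Classes of ≈

  ≈-Class : Fin n → Subset n → Set
  ≈-Class u C = u ∈ C × (∀ v → v ∈ C → _≈G_ G u v) × (∀ v → _≈G_ G u v → v ∈ C)

  ≈-Class-unique : ∀ {u C D} → ≈-Class u C → ≈-Class u D → C ≡ D
  ≈-Class-unique (_ , C≈ , ≈C) (_ , D≈ , ≈D) =
    ⊆-antisym (λ {v} v∈C → ≈D v (C≈ v v∈C)) (λ {v} v∈D → ≈C v (D≈ v v∈D))

  minimal-≈-Class : ∀ {M u} → InMmin G M → 3 ≤ ∣ M ∣ → u ∈ M → ≈-Class u M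
  minimal-≈-Class {M} minM 3≤∣M∣ u∈M = u∈M , (λ v v∈M → inj₂ (M , minM , u∈M , v∈M)) , ≈M
    where
    ≈M : ∀ v → _≈G_ G _ v → v ∈ M
    ≈M v (inj₁ refl) = u∈M
    ≈M v (inj₂ (N , minN , u∈N , v∈N)) = subst (v ∈_) (minimal-overlap minM 3≤∣M∣ minN u∈M u∈N) v∈N

  ≈-Class-dichotomy : ∀ {u C} → ≈-Class u C → 2 ≤ ∣ C ∣ →
    (InMmin G C × 3 ≤ ∣ C ∣) ⊎ (∃ λ w → w ≢ u × Twins u w × ∀ a → a ∈ C → Twins u a)
  ≈-Class-dichotomy {u} {C} cls@(u∈C , C≈ , _) 2≤∣C∣ with another-element u 2≤∣C∣
  ... | w , w∈C , w≢u with C≈ w w∈C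
  ...   | inj₁ refl = contradiction refl w≢u
  ...   | inj₂ (M , minM , u∈M , w∈M) with ∣ M ∣ ≤? 2
  ...     | yes ∣M∣≤2 = inj₂ (w , w≢u , twins-w , λ a a∈C → ≈-twins twins-w w≢u (C≈ a a∈C))
    where
    twins-w : Twins u w
    twins-w = small-module-twins (proj₁ (proj₁ minM)) u∈M w∈M w≢u ∣M∣≤2
  ...     | no ∣M∣≰2 = inj₁ (subst (λ D → InMmin G D × 3 ≤ ∣ D ∣) (sym C≡M) (minM , ≰⇒> ∣M∣≰2))
    where
    C≡M : C ≡ M
    C≡M = ≈-Class-unique cls (minimal-≈-Class minM (≰⇒> ∣M∣≰2) u∈M)

  ≈-Class-module : ∀ {u C} → ≈-Class u C → 2 ≤ ∣ C ∣ → IsModule G C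
  ≈-Class-module cls@(u∈C , _) 2≤∣C∣ with ≈-Class-dichotomy cls 2≤∣C∣
  ... | inj₁ (((modC , _) , _) , _) = modC
  ... | inj₂ (_ , _ , _ , twins)    = twin-set-module u∈C twins

  -- InC G K is definitionally MaximalUniform true K.
  MaximalUniform : Bool → Subset n → Set
  MaximalUniform e K = (InM G K × Uniform e K) × (∀ N → InM G N → Uniform e N → K ⊆ N → N ≡ K)

  uniform-false⇒stable : ∀ {M} → Uniform false M → IsStable G M
  uniform-false⇒stable unif a b a∈ b∈ with a ≟ b
  ... | yes refl = Graph.irrefl G a
  ... | no a≢b   = unif a b a∈ b∈ a≢b

  InS⇒MaximalUniform : ∀ {K} → InS G K → MaximalUniform false K
  InS⇒MaximalUniform ((inK , stable) , maxK) =
    (inK , λ a b a∈ b∈ _ → stable a b a∈ b∈) ,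
    λ N inN unifN K⊆N → maxK N inN (uniform-false⇒stable unifN) K⊆N

  MaximalUniform⇒InC⊎InS : ∀ e {K} → MaximalUniform e K → InC G K ⊎ InS G K
  MaximalUniform⇒InC⊎InS true  maxK                     = inj₁ maxK
  MaximalUniform⇒InC⊎InS false ((inK , unifK) , maxK) =
    inj₂ ((inK , uniform-false⇒stable unifK) ,
          λ N inN stableN K⊆N → maxK N inN (λ a b a∈ b∈ _ → stableN a b a∈ b∈) K⊆N)

  twin-≈-Class-maximal : ∀ {u w C} → ≈-Class u C → 2 ≤ ∣ C ∣ → w ≢ u → Twins u w →
                         (∀ a → a ∈ C → Twins u a) → MaximalUniform (A u w) C
  twin-≈-Class-maximal (u∈C , _ , ≈C) 2≤∣C∣ w≢u twins-w twins =
    ((twin-set-module u∈C twins , 2≤∣C∣) , twin-set-uniform twins twins-w w≢u) ,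
    λ N (modN , _) unifN C⊆N → ⊆-antisym
      (λ {x} x∈N → ≈C x (twins⇒≈ (uniform-module-twins modN unifN (C⊆N u∈C) x∈N))) C⊆N

  MaximalUniform-≈-Class : ∀ {e K u} → MaximalUniform e K → u ∈ K → ≈-Class u K
  MaximalUniform-≈-Class {K = K} {u} (((modK , 2≤∣K∣) , unifK) , maxK) u∈K =
    u∈K , (λ v v∈K → twins⇒≈ (twins v v∈K)) , ≈K
    where
    twins : ∀ a → a ∈ K → Twins u a
    twins a a∈K = uniform-module-twins modK unifK u∈K a∈K

    ≈K : ∀ x → _≈G_ G u x → x ∈ K
    ≈K x u≈x with another-element u 2≤∣K∣
    ... | v , v∈K , v≢u = subst (x ∈_) K∪x≡K (q⊆p∪q K ⁅ x ⁆ (x∈⁅x⁆ x))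
      where
      twins-K∪x : ∀ a → a ∈ K ∪ ⁅ x ⁆ → Twins u a
      twins-K∪x a a∈ with x∈p∪q⁻ K ⁅ x ⁆ a∈
      ... | inj₁ a∈K = twins a a∈K
      ... | inj₂ a∈x = subst (Twins u) (sym (x∈⁅y⁆⇒x≡y x a∈x)) (≈-twins (twins v v∈K) v≢u u≈x)

      K∪x≡K : K ∪ ⁅ x ⁆ ≡ K
      K∪x≡K = maxK (K ∪ ⁅ x ⁆)
        (twin-set-module (p⊆p∪q ⁅ x ⁆ u∈K) twins-K∪x , ≤-trans 2≤∣K∣ (∣p∣≤∣p∪q∣ K ⁅ x ⁆))
        (subst (λ e → Uniform e (K ∪ ⁅ x ⁆)) (unifK u v u∈K v∈K (≢-sym v≢u))
               (twin-set-uniform twins-K∪x (twins v v∈K) v≢u))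
        (p⊆p∪q ⁅ x ⁆)

  ≈-Class⇒InC⊎InS⊎InP : ∀ {u C} → ≈-Class u C → 2 ≤ ∣ C ∣ → InC G C ⊎ InS G C ⊎ InP G C
  ≈-Class⇒InC⊎InS⊎InP {u} cls 2≤∣C∣ with ≈-Class-dichotomy cls 2≤∣C∣
  ... | inj₁ (minC , 3≤∣C∣) = inj₂ (inj₂ (minimal-prime minC 3≤∣C∣))
  ... | inj₂ (w , w≢u , twins-w , twins) =
    map₂ inj₁ (MaximalUniform⇒InC⊎InS (A u w) (twin-≈-Class-maximal cls 2≤∣C∣ w≢u twins-w twins))

  private
    ≈-Class-of-members : ∀ {C} → 2 ≤ ∣ C ∣ → (∀ {u} → u ∈ C → ≈-Class u C) → InFrakM G C × 2 ≤ ∣ C ∣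
    ≈-Class-of-members 2≤∣C∣ cls with 1≤∣p∣⇒Nonempty (≤-trans (s≤s z≤n) 2≤∣C∣)
    ... | u , u∈C = (u , cls u∈C) , 2≤∣C∣

  InC⊎InS⊎InP⇒≈-Class : ∀ {C} → InC G C ⊎ InS G C ⊎ InP G C → InFrakM G C × 2 ≤ ∣ C ∣
  InC⊎InS⊎InP⇒≈-Class (inj₁ maxC) =
    ≈-Class-of-members (proj₂ (proj₁ (proj₁ maxC))) (MaximalUniform-≈-Class maxC)
  InC⊎InS⊎InP⇒≈-Class (inj₂ (inj₁ maxS)) =
    ≈-Class-of-members (proj₂ (proj₁ (proj₁ maxS)))
      (MaximalUniform-≈-Class (InS⇒MaximalUniform maxS))
  InC⊎InS⊎InP⇒≈-Class (inj₂ (inj₂ primeC@(_ , 4≤∣C∣ , _))) =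
    ≈-Class-of-members (≤-trans (s≤s (s≤s z≤n)) 4≤∣C∣)
      (minimal-≈-Class (prime-minimal primeC) (≤-trans (s≤s (s≤s (s≤s z≤n))) 4≤∣C∣))

  -- Strong modules and ⇑

  ≈-sym : ∀ {u w} → _≈G_ G u w → _≈G_ G w u
  ≈-sym (inj₁ refl)                  = inj₁ refl
  ≈-sym (inj₂ (M , minM , u∈M , w∈M)) = inj₂ (M , minM , w∈M , u∈M)

  -- U ⊆ {c}^⇑; the leastness clause of IsUp G ⁅ c ⁆ U is literally U ⊆⇑ c.
  _⊆⇑_ : Subset n → Fin n → Set
  U ⊆⇑ c = ∀ S → IsStrong G S → ⁅ c ⁆ ⊂ S → U ⊆ S

  strong-⊇-minimal : ∀ {S M u} → IsStrong G S → ⁅ u ⁆ ⊂ S → InMmin G M → u ∈ M → M ⊆ S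
  strong-⊇-minimal {S} {M} {u} (modS , nested) u⊂S ((modM , _) , minM) u∈M
    with nested M modM (u , ⁅x⁆⊂⇒∈ u⊂S , u∈M)
  ... | inj₂ M⊆S = M⊆S
  ... | inj₁ S⊆M with ⁅x⁆⊂⇒∃ u⊂S
  ...   | s , s∈S , s≢u =
    ⊆-reflexive (sym (minM S (modS , distinct⇒2≤∣p∣ (⁅x⁆⊂⇒∈ u⊂S) s∈S (≢-sym s≢u)) S⊆M))

  ≈-⊂ : ∀ {u w S} → _≈G_ G u w → IsStrong G S → ⁅ u ⁆ ⊂ S → ⁅ w ⁆ ⊂ S
  ≈-⊂ (inj₁ refl) _ u⊂S = u⊂S
  ≈-⊂ {u} {w} (inj₂ (M , minM , u∈M , w∈M)) strongS u⊂S with w ≟ u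
  ... | yes refl = u⊂S
  ... | no w≢u   = ⁅x⁆⊂⁺ (strong-⊇-minimal strongS u⊂S minM u∈M w∈M) (⁅x⁆⊂⇒∈ u⊂S) (≢-sym w≢u)

  ≈-IsUp : ∀ {u w U} → _≈G_ G u w → IsUp G ⁅ u ⁆ U → IsUp G ⁅ w ⁆ U
  ≈-IsUp u≈w ((strongU , u⊂U) , U⊆⇑u) =
    (strongU , ≈-⊂ u≈w strongU u⊂U) ,
    λ S strongS w⊂S → U⊆⇑u S strongS (≈-⊂ (≈-sym u≈w) strongS w⊂S)

  ⊤-strong : IsStrong G ⊤
  ⊤-strong = (λ x x∉⊤ → contradiction ∈⊤ x∉⊤) , λ _ _ _ → inj₂ ⊆⊤

  ⇑-exists : 2 ≤ n → ∀ u → ∃ (IsUp G ⁅ u ⁆)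
  ⇑-exists 2≤n u with another-element {p = ⊤} u (subst (2 ≤_) (sym (∣⊤∣≡n n)) 2≤n)
  ... | s , _ , s≢u
    with ⊆-minimal (λ S → IsStrong? S ×-dec ⁅ u ⁆ ⊂? S) ⊤ (⊤-strong , ⁅x⁆⊂⁺ ∈⊤ ∈⊤ s≢u)
  ...   | U , (strongU , u⊂U) , _ , minU = U , (strongU , u⊂U) , least
    where
    least : U ⊆⇑ u
    least S strongS u⊂S with proj₂ strongU S (proj₁ strongS) (u , ⁅x⁆⊂⇒∈ u⊂U , ⁅x⁆⊂⇒∈ u⊂S)
    ... | inj₁ U⊆S = U⊆S
    ... | inj₂ S⊆U = minU S (strongS , u⊂S) S⊆U

  -- Splitting a module

  Closed : Bool → Subset n → Subset n → Set
  Closed e U X = X ⊆ U × (∀ a b → a ∈ X → b ∈ U → b ∉ X → A a b ≡ e)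

  Closed? : ∀ e U → Decidable (Closed e U)
  Closed? e U X = X ⊆? U ×-dec all? λ a → all? λ b →
    a ∈? X →-dec (b ∈? U →-dec (¬? (b ∈? X) →-dec (A a b ≟ᵇ e)))

  -- Splits false U: G[U] is disconnected; Splits true U: its complement is.
  Splits : Bool → Subset n → Set
  Splits e U = ∃ λ X → Closed e U X × Nonempty X × ∃ λ b → b ∈ U × b ∉ X

  Splits? : ∀ e → Decidable (Splits e)
  Splits? e U = anySubset? λ X →
    Closed? e U X ×-dec (nonempty? X ×-dec any? λ b → b ∈? U ×-dec ¬? (b ∈? X))

  splits-or-not : ∀ U → (∃ λ e → Splits e U) ⊎ (∀ e → ¬ Splits e U)
  splits-or-not U with Splits? true U | Splits? false U
  ... | yes split | _         = inj₁ (true , split)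
  ... | no _      | yes split = inj₁ (false , split)
  ... | no ¬true  | no ¬false = inj₂ λ { true → ¬true ; false → ¬false }

  closed-module : ∀ {e U X} → IsModule G U → Closed e U X → IsModule G X
  closed-module {U = U} modU (X⊆U , closed) x x∉X a b a∈X b∈X with x ∈? U
  ... | no x∉U  = modU x x∉U a b (X⊆U a∈X) (X⊆U b∈X)
  ... | yes x∈U = trans (A-sym x a) (trans (closed a x a∈X x∈U x∉X)
                    (sym (trans (A-sym x b) (closed b x b∈X x∈U x∉X))))

  closed-complement : ∀ {e U X} → Closed e U X → Closed e U (U ─ X)
  closed-complement {U = U} {X} (X⊆U , closed) = p─q⊆p U X , λ a b a∈U─X b∈U b∉U─X →
    trans (A-sym a b) (closed b a
      (decidable-stable (b ∈? X) (λ b∉X → b∉U─X (x∈p∧x∉q⇒x∈p─q b∈U b∉X)))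
      (p─q⊆p U X a∈U─X) (x∈p─q⇒x∉q U X a∈U─X))

  closed-crossing : ∀ {e U X N z t} → IsModule G U → Closed e U X → z ∈ U → z ∉ X →
                    IsModule G N → t ∈ N → t ∉ X →
                    ∀ {a b} → a ∈ X → a ∈ N → b ∈ X → b ∉ N → A a b ≡ e
  closed-crossing {e} {U} {N = N} {z} {t} modU (X⊆U , closed) z∈U z∉X modN t∈N t∉X {a} {b}
                  a∈X a∈N b∈X b∉N = through-N (t ∈? U) (z ∈? N)
    where
    via : ∀ {w} → w ∈ N → A b w ≡ e → A a b ≡ e
    via {w} w∈N A-b-w≡e = trans (A-sym a b) (trans (modN b b∉N a w a∈N w∈N) A-b-w≡e)

    through-N : Dec (t ∈ U) → Dec (z ∈ N) → A a b ≡ e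
    through-N (yes t∈U) _         = via t∈N (closed b t b∈X t∈U t∉X)
    through-N (no _)    (yes z∈N) = via z∈N (closed b z b∈X z∈U z∉X)
    through-N (no t∉U)  (no z∉N)  = via t∈N (begin
      A b t  ≡⟨ A-sym b t ⟩
      A t b  ≡⟨ modU t t∉U b z (X⊆U b∈X) z∈U ⟩
      A t z  ≡⟨ A-sym t z ⟩
      A z t  ≡⟨ modN z z∉N t a t∈N a∈N ⟩
      A z a  ≡⟨ A-sym z a ⟩
      A a z  ≡⟨ closed a z a∈X z∈U z∉X ⟩
      e      ∎)
      where open ≡-Reasoning

  module _ {e U X N} (closedX : Closed e U X)
           (across : ∀ {a b} → a ∈ X → a ∈ N → b ∈ X → b ∉ N → A a b ≡ e) where

    closed-∩ : Closed e U (X ∩ N)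
    closed-∩ = ⊆-trans (p∩q⊆p X N) (proj₁ closedX) , closed
      where
      closed : ∀ a b → a ∈ X ∩ N → b ∈ U → b ∉ X ∩ N → A a b ≡ e
      closed a b a∈ b∈U b∉ with b ∈? X
      ... | yes b∈X = across (p∩q⊆p X N a∈) (p∩q⊆q X N a∈) b∈X (λ b∈N → b∉ (x∈p∩q⁺ (b∈X , b∈N)))
      ... | no b∉X  = proj₂ closedX a b (p∩q⊆p X N a∈) b∈U b∉X

    closed-─ : Closed e U (X ─ N)
    closed-─ = ⊆-trans (p─q⊆p X N) (proj₁ closedX) , closed
      where
      closed : ∀ a b → a ∈ X ─ N → b ∈ U → b ∉ X ─ N → A a b ≡ e
      closed a b a∈ b∈U b∉ with b ∈? X
      ... | yes b∈X = trans (A-sym a b)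
            (across b∈X (decidable-stable (b ∈? N) (λ b∉N → b∉ (x∈p∧x∉q⇒x∈p─q b∈X b∉N)))
                    (p─q⊆p X N a∈) (x∈p─q⇒x∉q X N a∈))
      ... | no b∉X  = proj₂ closedX a b (p─q⊆p X N a∈) b∈U b∉X

  -- A module N crossing X cuts it into X ∩ N and X ─ N, both again closed by closed-crossing,
  -- and the one containing c contradicts the minimality of X.
  minimal-closed-strong : ∀ {e U X c z} → IsModule G U → Closed e U X → c ∈ X → z ∈ U → z ∉ X →
                          (∀ T → Closed e U T × c ∈ T → T ⊆ X → X ⊆ T) → IsStrong G X
  minimal-closed-strong {e} {X = X} {c} modU closedX c∈X z∈U z∉X minX =
    closed-module modU closedX , nested
    where
    nested : ∀ N → IsModule G N → Σ (Fin n) (λ x → x ∈ X × x ∈ N) → X ⊆ N ⊎ N ⊆ X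
    nested N modN (y , y∈X , y∈N) with X ⊆? N
    ... | yes X⊆N = inj₁ X⊆N
    ... | no X⊈N  = inj₂ (decidable-stable (N ⊆? X) λ N⊈X → crossing (⊈⇒∃ X⊈N) (⊈⇒∃ N⊈X))
      where
      crossing : (∃ λ x → x ∈ X × x ∉ N) → (∃ λ t → t ∈ N × t ∉ X) → ⊥
      crossing (x , x∈X , x∉N) (t , t∈N , t∉X) = part-containing-c (c ∈? N)
        where
        across : ∀ {a b} → a ∈ X → a ∈ N → b ∈ X → b ∉ N → A a b ≡ e
        across = closed-crossing modU closedX z∈U z∉X modN t∈N t∉X

        part-containing-c : Dec (c ∈ N) → ⊥
        part-containing-c (yes c∈N) = x∉N (p∩q⊆q X N
          (minX (X ∩ N) (closed-∩ closedX across , x∈p∩q⁺ (c∈X , c∈N)) (p∩q⊆p X N) x∈X))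
        part-containing-c (no c∉N) = x∈p─q⇒x∉q X N
          (minX (X ─ N) (closed-─ closedX across , x∈p∧x∉q⇒x∈p─q c∈X c∉N) (p─q⊆p X N) y∈X) y∈N

  closed-around : ∀ {e U c} → Splits e U → c ∈ U →
                  ∃ λ X → Closed e U X × c ∈ X × ∃ λ z → z ∈ U × z ∉ X
  closed-around {U = U} {c} (X , closedX , (a , a∈X) , b , b∈U , b∉X) c∈U with c ∈? X
  ... | yes c∈X = X , closedX , c∈X , b , b∈U , b∉X
  ... | no c∉X  = U ─ X , closed-complement closedX , x∈p∧x∉q⇒x∈p─q c∈U c∉X ,
                  a , proj₁ closedX a∈X , λ a∈U─X → x∈p─q⇒x∉q U X a∈U─X a∈X

  -- The smallest closed set around c is strong, so it is {c}: otherwise it would contain U.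
  split-adjacent : ∀ {e U c} → IsModule G U → c ∈ U → U ⊆⇑ c → Splits e U →
                   ∀ d → d ∈ U → d ≢ c → A c d ≡ e
  split-adjacent {e} {U} {c} modU c∈U U⊆⇑c split d d∈U d≢c with closed-around split c∈U
  ... | X , closedX , c∈X , z , z∈U , z∉X
    with ⊆-minimal (λ T → Closed? e U T ×-dec c ∈? T) X (closedX , c∈X)
  ...   | T , (closedT , c∈T) , T⊆X , minT = proj₂ closedT c d c∈T d∈U d∉T
    where
    d∉T : d ∉ T
    d∉T d∈T = z∉X (T⊆X (U⊆⇑c T strongT (⁅x⁆⊂⁺ c∈T d∈T d≢c) z∈U))
      where
      strongT : IsStrong G T
      strongT = minimal-closed-strong modU closedT c∈T z∈U (λ z∈T → z∉X (T⊆X z∈T)) minT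

  split-twins : ∀ {e U u v} → IsModule G U → u ∈ U → v ∈ U → U ⊆⇑ u → U ⊆⇑ v → Splits e U →
                Twins u v
  split-twins {U = U} {u} {v} modU u∈U v∈U U⊆⇑u U⊆⇑v split y y≢u y≢v with y ∈? U
  ... | no y∉U  = modU y y∉U u v u∈U v∈U
  ... | yes y∈U = trans (A-sym y u) (trans (split-adjacent modU u∈U U⊆⇑u split y y∈U y≢u)
                    (sym (trans (A-sym y v) (split-adjacent modU v∈U U⊆⇑v split y y∈U y≢v))))

  overhanging-split : ∀ {U X t y z} → IsModule G U → IsModule G X → t ∈ X → t ∉ U →
                      y ∈ X → y ∈ U → z ∈ U → z ∉ X → Splits (A z y) U
  overhanging-split {U} {X} {t} {y} {z} modU modX t∈X t∉U y∈X y∈U z∈U z∉X =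
    X ∩ U , (p∩q⊆q X U , closed) , (y , x∈p∩q⁺ (y∈X , y∈U)) , z , z∈U , z∉X ∘ p∩q⊆p X U
    where
    closed : ∀ a b → a ∈ X ∩ U → b ∈ U → b ∉ X ∩ U → A a b ≡ A z y
    closed a b a∈ b∈U b∉ = begin
      A a b  ≡⟨ A-sym a b ⟩
      A b a  ≡⟨ modX b (λ b∈X → b∉ (x∈p∩q⁺ (b∈X , b∈U))) a t (p∩q⊆p X U a∈) t∈X ⟩
      A b t  ≡⟨ A-sym b t ⟩
      A t b  ≡⟨ modU t t∉U b z b∈U z∈U ⟩
      A t z  ≡⟨ A-sym t z ⟩
      A z t  ≡⟨ modX z z∉X t y t∈X y∈X ⟩
      A z y  ∎
      where open ≡-Reasoning

  crossing-split : ∀ {U Y N p y} → IsModule G Y → IsModule G N → N ⊆ U →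
                   (∀ {b} → b ∈ U → b ∈ Y ⊎ b ∈ N) →
                   p ∈ N → p ∉ Y → y ∈ Y → y ∉ N → y ∈ U → Splits (A y p) U
  crossing-split {U} {Y} {N} {p} {y} modY modN N⊆U cover p∈N p∉Y y∈Y y∉N y∈U =
    N ─ Y , (⊆-trans (p─q⊆p N Y) N⊆U , closed) , (p , x∈p∧x∉q⇒x∈p─q p∈N p∉Y) ,
    y , y∈U , y∉N ∘ p─q⊆p N Y
    where
    closed : ∀ a b → a ∈ N ─ Y → b ∈ U → b ∉ N ─ Y → A a b ≡ A y p
    closed a b a∈ b∈U b∉ = begin
      A a b  ≡⟨ modY a (x∈p─q⇒x∉q N Y a∈) b y b∈Y y∈Y ⟩
      A a y  ≡⟨ A-sym a y ⟩
      A y a  ≡⟨ modN y y∉N a p (p─q⊆p N Y a∈) p∈N ⟩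
      A y p  ∎
      where
      open ≡-Reasoning
      b∈Y : b ∈ Y
      b∈Y = [ (λ b∈Y → b∈Y) ,
              (λ b∈N → decidable-stable (b ∈? Y) (λ b∉Y → b∉ (x∈p∧x∉q⇒x∈p─q b∈N b∉Y))) ]′
            (cover b∈U)

  module _ {U N z} (modU : IsModule G U) (modN : IsModule G N) (N⊆U : N ⊆ U)
           (z∈U : z ∈ U) (z∉N : z ∉ N)
           (maxN : ∀ Z → IsModule G Z → N ⊆ Z → Z ⊆ U → (∃ λ w → w ∈ U × w ∉ Z) → Z ⊆ N) where

    crossing-maximal-submodule-splits : ∀ {X y₀ p t} → IsModule G X → y₀ ∈ N → y₀ ∈ X →
      p ∈ N → p ∉ X → t ∈ X → t ∉ N → ∃ λ e → Splits e U
    crossing-maximal-submodule-splits {X} {y₀} {p} {t} modX y₀∈N y₀∈X p∈N p∉X t∈X t∉N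
      with X ∩ U ⊆? N
    ... | yes X∩U⊆N = _ , overhanging-split modU modX t∈X
            (λ t∈U → t∉N (X∩U⊆N (x∈p∩q⁺ (t∈X , t∈U)))) y₀∈X (N⊆U y₀∈N)
            z∈U (λ z∈X → z∉N (X∩U⊆N (x∈p∩q⁺ (z∈X , z∈U))))
    ... | no X∩U⊈N = extend (⊈⇒∃ X∩U⊈N) (any? λ w → w ∈? U ×-dec ¬? (w ∈? (X ∩ U) ∪ N))
      where
      modY : IsModule G (X ∩ U)
      modY = IsModule-∩ modX modU

      extend : (∃ λ y → y ∈ X ∩ U × y ∉ N) → Dec (∃ λ w → w ∈ U × w ∉ (X ∩ U) ∪ N) →
               ∃ λ e → Splits e U
      extend (y , y∈X∩U , y∉N) (yes escapee) = contradiction (maxN ((X ∩ U) ∪ N)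
          (IsModule-∪ modY modN (x∈p∩q⁺ (y₀∈X , N⊆U y₀∈N)) y₀∈N) (q⊆p∪q (X ∩ U) N)
          (λ b∈ → [ p∩q⊆q X U , N⊆U ]′ (x∈p∪q⁻ (X ∩ U) N b∈)) escapee (p⊆p∪q N y∈X∩U))
        y∉N
      extend (y , y∈X∩U , y∉N) (no ∄) =
        _ , crossing-split modY modN N⊆U cover p∈N (p∉X ∘ p∩q⊆p X U) y∈X∩U y∉N (p∩q⊆q X U y∈X∩U)
        where
        cover : ∀ {b} → b ∈ U → b ∈ X ∩ U ⊎ b ∈ N
        cover {b} b∈U = x∈p∪q⁻ (X ∩ U) N
          (decidable-stable (b ∈? (X ∩ U) ∪ N) (λ b∉ → ∄ (b , b∈U , b∉)))

    maximal-proper-submodule-strong : (∀ e → ¬ Splits e U) → IsStrong G N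
    maximal-proper-submodule-strong unsplit = modN , nested
      where
      nested : ∀ X → IsModule G X → Σ (Fin n) (λ x → x ∈ N × x ∈ X) → N ⊆ X ⊎ X ⊆ N
      nested X modX (y₀ , y₀∈N , y₀∈X) with N ⊆? X
      ... | yes N⊆X = inj₁ N⊆X
      ... | no N⊈X  = inj₂ (decidable-stable (X ⊆? N) λ X⊈N →
        let p , p∈N , p∉X = ⊈⇒∃ N⊈X
            t , t∈X , t∉N = ⊈⇒∃ X⊈N
            e , split     = crossing-maximal-submodule-splits modX y₀∈N y₀∈X p∈N p∉X t∈X t∉N
        in  unsplit e split)

  unsplit-⊆ : ∀ {U N c s} → IsModule G U → (∀ e → ¬ Splits e U) → U ⊆⇑ c →
              IsModule G N → c ∈ N → s ∈ N → s ≢ c → N ⊆ U → U ⊆ N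
  unsplit-⊆ {U} {N} modU unsplit U⊆⇑c modN c∈N s∈N s≢c N⊆U =
    decidable-stable (U ⊆? N) (λ U⊈N → no-proper-submodule (⊈⇒∃ U⊈N))
    where
    no-proper-submodule : ¬ ∃ λ z → z ∈ U × z ∉ N
    no-proper-submodule (z , z∈U , z∉N)
      with ⊆-maximal (λ X → IsModule? X ×-dec (N ⊆? X ×-dec (X ⊆? U ×-dec
                                 any? λ w → w ∈? U ×-dec ¬? (w ∈? X))))
                     N (modN , ⊆-refl , N⊆U , z , z∈U , z∉N)
    ... | N* , (modN* , N⊆N* , N*⊆U , z* , z*∈U , z*∉N*) , _ , maxN* =
      z*∉N* (U⊆⇑c N* strongN* (⁅x⁆⊂⁺ (N⊆N* c∈N) (N⊆N* s∈N) s≢c) z*∈U)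
      where
      strongN* : IsStrong G N*
      strongN* = maximal-proper-submodule-strong modU modN* N*⊆U z*∈U z*∉N*
        (λ Z modZ N*⊆Z Z⊆U escapee → maxN* Z (modZ , ⊆-trans N⊆N* N*⊆Z , Z⊆U , escapee) N*⊆Z)
        unsplit

  -- Classes of ↔

  ↔-Class : Fin n → Subset n → Set
  ↔-Class u C = u ∈ C × (∀ v → v ∈ C → _↔G_ G u v) × (∀ v → _↔G_ G u v → v ∈ C)

  minimal-⇑-⊆ : ∀ {M u U} → InMmin G M → 3 ≤ ∣ M ∣ → u ∈ M → IsUp G ⁅ u ⁆ U → U ⊆ M
  minimal-⇑-⊆ {u = u} minM 3≤∣M∣ u∈M (_ , U⊆⇑u)
    with another-element u (≤-trans (s≤s (s≤s z≤n)) 3≤∣M∣)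
  ... | w , w∈M , w≢u = U⊆⇑u _ (minimal-strong minM 3≤∣M∣) (⁅x⁆⊂⁺ u∈M w∈M w≢u)

  twin-⇑-twins : ∀ {u w v U} → Twins u w → w ≢ u → IsUp G ⁅ u ⁆ U → IsUp G ⁅ v ⁆ U → Twins u v
  twin-⇑-twins {u} {w} {v} {U} twins-w w≢u upU@((strongU , u⊂U) , U⊆⇑u) ((_ , v⊂U) , U⊆⇑v) =
    by-split (splits-or-not U)
    where
    u∈U : u ∈ U
    u∈U = ⁅x⁆⊂⇒∈ u⊂U
    v∈U : v ∈ U
    v∈U = ⁅x⁆⊂⇒∈ v⊂U
    w∈U : w ∈ U
    w∈U = ⁅x⁆⊂⇒∈ (proj₂ (proj₁ (≈-IsUp (twins⇒≈ twins-w) upU)))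

    by-split : (∃ λ e → Splits e U) ⊎ (∀ e → ¬ Splits e U) → Twins u v
    by-split (inj₁ (_ , split)) = split-twins (proj₁ strongU) u∈U v∈U U⊆⇑u U⊆⇑v split
    by-split (inj₂ unsplit) with ∈pair⁻ (unsplit-⊆ (proj₁ strongU) unsplit U⊆⇑u
      (pair-twins-module twins-w) (u∈pair u w) (w∈pair u w) w≢u (pair⊆ u∈U w∈U) v∈U)
    ... | inj₁ refl = twins-refl u
    ... | inj₂ refl = twins-w

  ≈-Class⇒↔-Class : 2 ≤ n → ∀ {u C} → ≈-Class u C → 2 ≤ ∣ C ∣ → ↔-Class u C
  ≈-Class⇒↔-Class 2≤n {u} {C} cls@(u∈C , C≈ , ≈C) 2≤∣C∣ = u∈C , C↔ , ↔C
    where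
    C↔ : ∀ v → v ∈ C → _↔G_ G u v
    C↔ v v∈C with ⇑-exists 2≤n u
    ... | U , upU = U , upU , ≈-IsUp (C≈ v v∈C) upU

    ↔C : ∀ v → _↔G_ G u v → v ∈ C
    ↔C v (U , upU , upV@((_ , v⊂U) , _)) with ≈-Class-dichotomy cls 2≤∣C∣
    ... | inj₁ (minC , 3≤∣C∣)           = minimal-⇑-⊆ minC 3≤∣C∣ u∈C upU (⁅x⁆⊂⇒∈ v⊂U)
    ... | inj₂ (w , w≢u , twins-w , _) = ≈C v (twins⇒≈ (twin-⇑-twins twins-w w≢u upU upV))

  ↔-Class-⊆⇑ : ∀ {u C c} → ↔-Class u C → c ∈ C → C ⊆⇑ c
  ↔-Class-⊆⇑ {c = c} (_ , C↔ , _) c∈C S strongS c⊂S {v} v∈C with C↔ c c∈C | C↔ v v∈C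
  ... | Y , ((strongY , u⊂Y) , _) , (_ , Y⊆⇑c) | Y′ , (_ , Y′⊆⇑u) , ((_ , v⊂Y′) , _) =
    Y⊆⇑c S strongS c⊂S (Y′⊆⇑u Y strongY u⊂Y (⁅x⁆⊂⇒∈ v⊂Y′))

  ↔-Class⇒≈-Class : ∀ {u C} → ↔-Class u C → InM G C → ≈-Class u C
  ↔-Class⇒≈-Class {u} {C} cls@(u∈C , C↔ , ↔C) inC@(modC , _) = u∈C , C≈ , ≈C
    where
    ≈C : ∀ v → _≈G_ G u v → v ∈ C
    ≈C v u≈v with C↔ u u∈C
    ... | U , upU , _ = ↔C v (U , upU , ≈-IsUp u≈v upU)

    minC : (∀ e → ¬ Splits e C) → ∀ N → InM G N → N ⊆ C → N ≡ C
    minC unsplit N (modN , 2≤∣N∣) N⊆C with 1≤∣p∣⇒Nonempty (≤-trans (s≤s z≤n) 2≤∣N∣)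
    ... | c , c∈N with another-element c 2≤∣N∣
    ...   | s , s∈N , s≢c =
      ⊆-antisym N⊆C (unsplit-⊆ modC unsplit (↔-Class-⊆⇑ cls (N⊆C c∈N)) modN c∈N s∈N s≢c N⊆C)

    C≈ : ∀ v → v ∈ C → _≈G_ G u v
    C≈ v v∈C with splits-or-not C
    ... | inj₁ (_ , split) = twins⇒≈
          (split-twins modC u∈C v∈C (↔-Class-⊆⇑ cls u∈C) (↔-Class-⊆⇑ cls v∈C) split)
    ... | inj₂ unsplit     = inj₂ (C , (inC , minC unsplit) , u∈C , v∈C)

proposition20 : (n : ℕ) → 2 ≤ n → (G : Graph n) → (C : Subset n) →
    ((InFrakS G C × InM G C) ⇔ (InFrakM G C × 2 ≤ ∣ C ∣)) ×
    ((InFrakM G C × 2 ≤ ∣ C ∣) ⇔ (InC G C ⊎ InS G C ⊎ InP G C))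
proposition20 n 2≤n G C =
  mk⇔ (λ ((u , cls) , inC) → (u , ↔-Class⇒≈-Class G cls inC) , proj₂ inC)
      (λ ((u , cls) , 2≤∣C∣) →
         (u , ≈-Class⇒↔-Class G 2≤n cls 2≤∣C∣) , ≈-Class-module G cls 2≤∣C∣ , 2≤∣C∣) ,
  mk⇔ (λ ((u , cls) , 2≤∣C∣) → ≈-Class⇒InC⊎InS⊎InP G cls 2≤∣C∣)
      (InC⊎InS⊎InP⇒≈-Class G)
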